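{- For every $n\ge1$, the map $\Psi$ defined in the context, restricted to labeled Dyck paths of length $2n$ (labeled ballot paths of length $2n$ ending on the $x$-axis), is a bijection onto the set of alternating permutations on $[2n]$, i.e. ordinary permutations $\pi_1\cdots\pi_{2n}$ of $[2n]$ (no negative entries) with $\pi_1>\pi_2<\pi_3>\cdots>\pi_{2n}$.
   Context: A ballot path of length $m$ is a lattice path from $(0,0)$ with $m$ steps, each an up step $u=(1,1)$ or a down step $d=(1,-1)$, never going below the $x$-axis. The height of a step is the smaller $y$-coordinate of its endpoints. A labeled ballot path $(P;W)$ is a ballot path $P=p_1\cdots p_m$ whose steps carry integer labels $w_i$ with $0\le w_i\le$ height of $p_i$. Contracting a step of a path means deleting it and concatenating the remaining steps in order (so the result is again a path from the origin). A signed permutation on $[m]$ is a permutation of $[m]$ with minus signs attached to some entries ($\bar i=-i$). The map $\Psi$ from labeled ballot paths of length $m$ to signed permutations on $[m]$: start with $(P_1;W_1)=(P;W)$ and $\Gamma_0$ the empty word; each step of the current path keeps its index $r$ in the original path $P$. For $i=1,\dots,m$, given $(P_i;W_i)$ (with $m-i+1$ steps) and $\Gamma_{i-1}$, choose a step $p_{r_i}$ of $P_i$, contract it to get $P_{i+1}$, update labels to get $W_{i+1}$, and form $\Gamma_i$, as follows. Case 1 ($P_i$ has an odd number of steps): if some down step of $P_i$ has label equal to its height, let $p_{r_i}$ be the leftmost such; contract it, add $1$ to the labels of all down steps of $P_{i+1}$, and set $\Gamma_i=\overline{m-r_i+1}\,\Gamma_{i-1}$. Otherwise let $p_{r_i}$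 be the rightmost up step labeled $0$; contract it, subtract $1$ from the labels of the up steps originally to the right of $p_{r_i}$, add $1$ to the labels of the down steps originally to the left of $p_{r_i}$, and set $\Gamma_i=(m-r_i+1)\Gamma_{i-1}$. Case 2 ($P_i$ has an even number of steps): if some down step of $P_i$ is labeled $0$, let $p_{r_i}$ be the leftmost such; contract it, add $1$ to the labels of the up steps originally to the right of $p_{r_i}$, subtract $1$ from the labels of the down steps originally to the left of $p_{r_i}$, and set $\Gamma_i=(m-r_i+1)\Gamma_{i-1}$. Otherwise let $p_{r_i}$ be the rightmost up step whose label equals its height; contract it, subtract $1$ from the labels of all down steps of $P_{i+1}$, and set $\Gamma_i=\overline{m-r_i+1}\,\Gamma_{i-1}$. Finally $\Psi(P;W)=\Gamma_m$. -}

module Defs where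

open import Data.Bool using (Bool; true; false; _∧_; if_then_else_)
open import Data.Nat as ℕ using (ℕ; zero; suc; _≤_; _<_; _>_; _∸_)
open import Data.Integer as ℤ using (ℤ; +_; -_)
open import Data.List using (List; []; _∷_; length; reverse; applyUpTo)
open import Data.Maybe using (Maybe; just; nothing)
open import Data.Product using (_×_; _,_)
open import Data.Unit using (⊤)
open import Data.Empty using (⊥)
open import Relation.Nullary.Decidable using (⌊_⌋)
open import Relation.Binary.PropositionalEquality using (_≡_)
open import Data.List.Relation.Binary.Permutation.Propositional using (_↭_)

data Step : Set where
  U D : Step   -- up step u = (1,1), down step d = (1,-1)

isU : Step → Bool
isU U = true
isU D = false

isD : Step → Bool
isD U = false
isD D = true

LPath : Set
LPath = List (Step × ℕ)

-- LB h e L : starting at height h, the labeled path L never goes below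
-- the x-axis, every label is between 0 and the height of its step
-- (the smaller y-coordinate of its endpoints), and L ends at height e.
LB : ℕ → ℕ → LPath → Set
LB h e [] = h ≡ e
LB h e ((U , w) ∷ L) = w ≤ h × LB (suc h) e L
LB zero e ((D , w) ∷ L) = ⊥
LB (suc h) e ((D , w) ∷ L) = w ≤ h × LB h e L

IsLabeledDyck : ℕ → LPath → Set
IsLabeledDyck n L = length L ≡ 2 ℕ.* n × LB 0 0 L

-- an entry of the current path: (original index r , step , current label)
Entry : Set
Entry = ℕ × Step × ℤ

-- annotated entry: (position in current path , entry , height in current path)
AEntry : Set
AEntry = ℕ × Entry × ℤ

annotate : ℤ → ℕ → List Entry → List AEntry
annotate y k [] = []
annotate y k ((r , U , w) ∷ es) = (k , (r , U , w) , y) ∷ annotate (y ℤ.+ ℤ.1ℤ) (suc k) es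
annotate y k ((r , D , w) ∷ es) = (k , (r , D , w) , y ℤ.- ℤ.1ℤ) ∷ annotate (y ℤ.- ℤ.1ℤ) (suc k) es

findFirst : {A : Set} → (A → Bool) → List A → Maybe A
findFirst p [] = nothing
findFirst p (x ∷ xs) = if p x then just x else findFirst p xs

contract : ℕ → (ℕ → Entry → Entry) → List AEntry → List Entry
contract k f [] = []
contract k f ((j , e , h) ∷ as) =
  if ⌊ j ℕ.≟ k ⌋ then contract k f as else f j e ∷ contract k f as

_==ℤ_ : ℤ → ℤ → Bool
a ==ℤ b = ⌊ a ℤ.≟ b ⌋

_<ℕ_ : ℕ → ℕ → Bool
a <ℕ b = ⌊ a ℕ.<? b ⌋

odd? : ℕ → Bool
odd? zero = false
odd? (suc zero) = true
odd? (suc (suc n)) = odd? n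

downAtHeight downZero upZero upAtHeight : AEntry → Bool
downAtHeight (_ , (_ , s , w) , h) = isD s ∧ (w ==ℤ h)
downZero (_ , (_ , s , w) , h) = isD s ∧ (w ==ℤ ℤ.0ℤ)
upZero (_ , (_ , s , w) , h) = isU s ∧ (w ==ℤ ℤ.0ℤ)
upAtHeight (_ , (_ , s , w) , h) = isU s ∧ (w ==ℤ h)

allDownsBy : ℤ → ℕ → Entry → Entry
allDownsBy c j (r , s , w) = (r , s , (if isD s then w ℤ.+ c else w))

sidesBy : ℕ → ℤ → ℤ → ℕ → Entry → Entry
sidesBy k cU cD j (r , s , w) =
  (r , s , (if isU s ∧ (k <ℕ j) then w ℤ.+ cU
            else if isD s ∧ (j <ℕ k) then w ℤ.+ cD else w))

-- one iteration of Ψ on a path of original length m: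
-- returns the contracted, relabeled path and the new first letter of Γ
-- (nothing if the required step does not exist)
ψStep : ℕ → List Entry → Maybe (List Entry × ℤ)
ψStep m es with annotate (+ 0) 0 es | odd? (length es)
... | as | true with findFirst downAtHeight as
...   | just (k , (r , _) , _) =
          just (contract k (allDownsBy ℤ.1ℤ) as , - (+ (m ∸ r ℕ.+ 1)))
...   | nothing with findFirst upZero (reverse as)
...     | just (k , (r , _) , _) =
            just (contract k (sidesBy k (- ℤ.1ℤ) ℤ.1ℤ) as , + (m ∸ r ℕ.+ 1))
...     | nothing = nothing
ψStep m es | as | false with findFirst downZero as
...   | just (k , (r , _) , _) =
          just (contract k (sidesBy k ℤ.1ℤ (- ℤ.1ℤ)) as , + (m ∸ r ℕ.+ 1))
...   | nothing with findFirst upAtHeight (reverse as)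
...     | just (k , (r , _) , _) =
            just (contract k (allDownsBy (- ℤ.1ℤ)) as , - (+ (m ∸ r ℕ.+ 1)))
...     | nothing = nothing

ψRun : ℕ → ℕ → List Entry → List ℤ → Maybe (List ℤ)
ψRun m zero es acc = just acc
ψRun m (suc i) es acc with ψStep m es
... | just (es' , x) = ψRun m i es' (x ∷ acc)
... | nothing = nothing

initEntries : ℕ → LPath → List Entry
initEntries r [] = []
initEntries r ((s , w) ∷ L) = (r , s , + w) ∷ initEntries (suc r) L

-- Ψ(P;W) as a signed permutation (word of nonzero integers, bar i = -i);
-- nothing if at some stage the prescribed step does not exist.
Ψ : LPath → Maybe (List ℤ)
Ψ L = ψRun (length L) (length L) (initEntries 1 L) []

mutual
  Down : List ℕ → Set
  Down [] = ⊤
  Down (a ∷ []) = ⊤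
  Down (a ∷ b ∷ xs) = a > b × Up (b ∷ xs)

  Up : List ℕ → Set
  Up [] = ⊤
  Up (a ∷ []) = ⊤
  Up (a ∷ b ∷ xs) = a < b × Down (b ∷ xs)

-- π is a permutation of [m] = {1,...,m} (in one-line notation)
IsPerm : ℕ → List ℕ → Set
IsPerm m π = π ↭ applyUpTo suc m

IsAlternatingPerm : ℕ → List ℕ → Set
IsAlternatingPerm m π = IsPerm m π × Down π

unsigned : List ℕ → List ℤ
unsigned [] = []
unsigned (x ∷ xs) = + x ∷ unsigned xs

-- On a labelled Dyck path Ψ alternates between contracting the leftmost down step labelled 0
-- (even stages) and the rightmost up step labelled 0 (odd stages): the relabelling turns a
-- labelled Dyck path into a labelled ballot path ending at height 1 whose down labels are all
-- smaller than their heights, and back, so the required step always exists and no bar is ever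
-- written.  A stage is undone by reinserting the contracted step at its original index and
-- shifting the labels back.  As the zero-labelled down steps lie to the right of the up step
-- contracted last, and the zero-labelled up steps to the left of the down step contracted last,
-- the contracted original indices satisfy r₁ > r₂ < r₃ > ⋯.  Hence labelled Dyck paths of length
-- 2n correspond to the permutations r₁ ⋯ r₂ₙ of [2n] of this shape, and Ψ sends them to
-- (2n+1-r₂ₙ) ⋯ (2n+1-r₁), which is alternating because reversing a sequence of even length and
-- applying x ↦ 2n+1-x each exchange the two alternating shapes.

module Submission where

open import Defs
open import Data.Nat using (ℕ; _≥_; _*_)
open import Data.List using (List)
open import Data.Maybe using (just)
open import Data.Product using (_×_; Σ; ∃)
open import Relation.Binary.PropositionalEquality using (_≡_)

open import Function using (_∘_)
open import Data.Bool using (Bool; true; false; _∧_; if_then_else_)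
open import Data.Empty using (⊥; ⊥-elim)
open import Data.Unit using (⊤; tt)
open import Data.Product using (_,_; proj₁; proj₂)
open import Data.Sum using (_⊎_; inj₁; inj₂)
open import Data.Maybe using (nothing)
open import Data.Maybe.Properties using (just-injective)
open import Data.Nat as ℕ using (zero; suc; _≤_; _<_; _∸_; z≤n; s≤s)
import Data.Nat.Properties as ℕₚ
open import Data.Nat.Induction using (<-wellFounded)
open import Induction.WellFounded using (Acc; acc)
open import Data.Integer as ℤ using (ℤ; +_; -_)
import Data.Integer.Properties as ℤₚ
open import Data.List using ([]; _∷_; _++_; _ʳ++_; map; length; reverse; applyUpTo; applyDownFrom; upTo)
import Data.List.Properties as Listₚ
open import Data.List.Relation.Unary.All as All using (All; []; _∷_)
import Data.List.Relation.Unary.All.Properties as Allₚ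
open import Data.List.Relation.Unary.AllPairs using ([]; _∷_)
open import Data.List.Relation.Unary.Unique.Propositional using (Unique)
import Data.List.Relation.Unary.Unique.Propositional.Properties as Uniqueₚ
open import Data.List.Relation.Binary.Permutation.Propositional
  using (_↭_; ↭-refl; ↭-reflexive; ↭-sym; ↭-trans; prep; swap; ↭⇒↭ₛ)
import Data.List.Relation.Binary.Permutation.Propositional.Properties as ↭ₚ
import Data.List.Relation.Binary.Permutation.Setoid.Properties as Setoid↭ₚ
open import Relation.Nullary using (yes; no; ¬_)
open import Relation.Nullary.Decidable using (⌊_⌋)
open import Relation.Binary.PropositionalEquality
  using (_≢_; refl; sym; trans; cong; cong₂; subst; setoid; module ≡-Reasoning)

module _ {A : Set} (p : A → Bool) where

  Miss : List A → Set
  Miss = All (λ x → p x ≡ false)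

  findFirst-hit : ∀ xs {a} ys → Miss xs → p a ≡ true → findFirst p (xs ++ a ∷ ys) ≡ just a
  findFirst-hit []       ys []         pa rewrite pa = refl
  findFirst-hit (x ∷ xs) ys (px ∷ pxs) pa rewrite px = findFirst-hit xs ys pxs pa

  findFirst-miss : ∀ {xs} → Miss xs → findFirst p xs ≡ nothing
  findFirst-miss []         = refl
  findFirst-miss (px ∷ pxs) rewrite px = findFirst-miss pxs

  FirstHit LastHit : List A → Set
  FirstHit xs = Σ (List A) λ pre → Σ A λ a → Σ (List A) λ post →
    xs ≡ pre ++ a ∷ post × Miss pre × p a ≡ true
  LastHit xs = Σ (List A) λ pre → Σ A λ a → Σ (List A) λ post →
    xs ≡ pre ++ a ∷ post × p a ≡ true × Miss post

  firstHit? : ∀ xs → Miss xs ⊎ FirstHit xs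
  firstHit? [] = inj₁ []
  firstHit? (x ∷ xs) with p x in px
  ... | true = inj₂ ([] , x , xs , refl , [] , px)
  ... | false with firstHit? xs
  ...   | inj₁ miss = inj₁ (px ∷ miss)
  ...   | inj₂ (pre , a , post , refl , miss , pa) = inj₂ (x ∷ pre , a , post , refl , px ∷ miss , pa)

  lastHit? : ∀ xs → Miss xs ⊎ LastHit xs
  lastHit? [] = inj₁ []
  lastHit? (x ∷ xs) with lastHit? xs
  ... | inj₂ (pre , a , post , refl , pa , miss) = inj₂ (x ∷ pre , a , post , refl , pa , miss)
  ... | inj₁ miss with p x in px
  ...   | true  = inj₂ ([] , x , xs , refl , px , miss)
  ...   | false = inj₁ (px ∷ miss)

  miss⇒¬hit : ∀ {x} → p x ≡ false → ¬ p x ≡ true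
  miss⇒¬hit px qx with () ← trans (sym px) qx

  Guarded : (A → Set) → A → Set
  Guarded P x = p x ≡ true → P x

  guard-miss : ∀ {P xs} → Miss xs → All (Guarded P) xs
  guard-miss = All.map (λ px qx → ⊥-elim (miss⇒¬hit px qx))

  guarded⇒miss : ∀ {P xs} → All (Guarded P) xs → All (¬_ ∘ P) xs → Miss xs
  guarded⇒miss []                 []           = []
  guarded⇒miss {xs = x ∷ _} (g ∷ gs) (¬Px ∷ ¬Ps) with p x in px
  ... | true  = ⊥-elim (¬Px (g refl))
  ... | false = px ∷ guarded⇒miss gs ¬Ps

reverse-middle : {A : Set} (xs : List A) (a : A) (ys : List A) →
                 reverse (xs ++ a ∷ ys) ≡ reverse ys ++ a ∷ reverse xs
reverse-middle xs a ys = begin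
  reverse (xs ++ a ∷ ys)              ≡⟨ Listₚ.reverse-++ xs (a ∷ ys) ⟩
  reverse (a ∷ ys) ++ reverse xs      ≡⟨ cong (_++ reverse xs) (Listₚ.unfold-reverse a ys) ⟩
  (reverse ys ++ a ∷ []) ++ reverse xs ≡⟨ Listₚ.++-assoc (reverse ys) (a ∷ []) (reverse xs) ⟩
  reverse ys ++ a ∷ reverse xs        ∎
  where open ≡-Reasoning

All-reverse : {A : Set} {P : A → Set} {xs : List A} → All P xs → All P (reverse xs)
All-reverse {xs = xs} = ↭ₚ.All-resp-↭ (↭-sym (↭ₚ.↭-reverse xs))

<ℕ-true : ∀ {a b} → a < b → (a <ℕ b) ≡ true
<ℕ-true {a} {b} a<b with a ℕ.<? b
... | yes _   = refl
... | no  a≮b = ⊥-elim (a≮b a<b)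

<ℕ-false : ∀ {a b} → ¬ a < b → (a <ℕ b) ≡ false
<ℕ-false {a} {b} a≮b with a ℕ.<? b
... | yes a<b = ⊥-elim (a≮b a<b)
... | no  _   = refl

≟-false : ∀ {a b} → a ≢ b → ⌊ a ℕ.≟ b ⌋ ≡ false
≟-false {a} {b} a≢b with a ℕ.≟ b
... | yes a≡b = ⊥-elim (a≢b a≡b)
... | no  _   = refl

≟-true : ∀ a → ⌊ a ℕ.≟ a ⌋ ≡ true
≟-true a with a ℕ.≟ a
... | yes _   = refl
... | no  a≢a = ⊥-elim (a≢a refl)

==ℤ-false : ∀ {a b} → a ≢ b → ((+ a) ==ℤ (+ b)) ≡ false
==ℤ-false {a} {b} a≢b with + a ℤ.≟ + b
... | yes eq = ⊥-elim (a≢b (ℤₚ.+-injective eq))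
... | no  _  = refl

+-cancel : ∀ {c d} → c ℤ.+ d ≡ ℤ.0ℤ → ∀ w → w ℤ.+ c ℤ.+ d ≡ w
+-cancel {c} {d} c+d≡0 w = begin
  w ℤ.+ c ℤ.+ d   ≡⟨ ℤₚ.+-assoc w c d ⟩
  w ℤ.+ (c ℤ.+ d) ≡⟨ cong (λ x → w ℤ.+ x) c+d≡0 ⟩
  w ℤ.+ ℤ.0ℤ      ≡⟨ ℤₚ.+-identityʳ w ⟩
  w               ∎
  where open ≡-Reasoning

index : Entry → ℕ
index (r , _) = r

indices : List Entry → List ℕ
indices = map index

shiftDowns shiftUps : ℤ → Entry → Entry
shiftDowns c (r , s , w) = r , s , (if isD s then w ℤ.+ c else w)
shiftUps   c (r , s , w) = r , s , (if isU s then w ℤ.+ c else w)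

isZeroDown isZeroUp : Entry → Bool
isZeroDown (_ , s , w) = isD s ∧ (w ==ℤ ℤ.0ℤ)
isZeroUp   (_ , s , w) = isU s ∧ (w ==ℤ ℤ.0ℤ)

label : Entry → ℤ
label (_ , _ , w) = w

Natural : Entry → Set
Natural e = ∃ λ n → label e ≡ + n

isZeroDown-hit : ∀ {r s w} → isZeroDown (r , s , w) ≡ true → s ≡ D × w ≡ + 0
isZeroDown-hit {s = D} {w} hit with w ℤ.≟ + 0
... | yes w≡0 = refl , w≡0

isZeroUp-hit : ∀ {r s w} → isZeroUp (r , s , w) ≡ true → s ≡ U × w ≡ + 0
isZeroUp-hit {s = U} {w} hit with w ℤ.≟ + 0
... | yes w≡0 = refl , w≡0

-- One stage of Ψ contracts a step and shifts the down labels to its left by δ and the up labels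
-- to its right by -δ: δ = -1 at even stages (a down step goes), δ = 1 at odd ones (an up step goes).
excise : ℤ → List Entry → List Entry → List Entry
excise δ pre post = map (shiftDowns δ) pre ++ map (shiftUps (- δ)) post

splice : ℤ → List Entry → Entry → List Entry → List Entry
splice δ pre e post = map (shiftDowns (- δ)) pre ++ e ∷ map (shiftUps δ) post

-- the inverse of a stage that removed the step with original index r
insertAt : ℕ → Step → ℤ → List Entry → List Entry
insertAt r s δ [] = (r , s , + 0) ∷ []
insertAt r s δ (e ∷ es) =
  if index e <ℕ r then shiftDowns (- δ) e ∷ insertAt r s δ es
  else (r , s , + 0) ∷ map (shiftUps δ) (e ∷ es)

insertDown insertUp : ℕ → List Entry → List Entry
insertDown r = insertAt r D (- ℤ.1ℤ)
insertUp   r = insertAt r U ℤ.1ℤ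

-- the path from which Ψ contracts the steps with original indices a, c, ... in this order
build : List ℕ → List Entry
build (a ∷ c ∷ rs) = insertDown a (insertUp c (build rs))
build _            = []

indices-shiftUps : ∀ c es → indices (map (shiftUps c) es) ≡ indices es
indices-shiftUps c es = sym (Listₚ.map-∘ es)

indices-insertAt : ∀ r s δ {xs} es → indices es ↭ xs → indices (insertAt r s δ es) ↭ r ∷ xs
indices-insertAt r s δ [] perm = prep r perm
indices-insertAt r s δ (e ∷ es) perm with index e <ℕ r
... | true  = ↭-trans (prep (index e) (indices-insertAt r s δ es ↭-refl))
                      (↭-trans (swap (index e) r ↭-refl) (prep r perm))
... | false = prep r (↭-trans (↭-reflexive (cong (index e ∷_) (indices-shiftUps δ es))) perm)

length-insertAt : ∀ r s δ es → length (insertAt r s δ es) ≡ suc (length es)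
length-insertAt r s δ es = begin
  length (insertAt r s δ es)          ≡⟨ Listₚ.length-map index (insertAt r s δ es) ⟨
  length (indices (insertAt r s δ es)) ≡⟨ ↭ₚ.↭-length (indices-insertAt r s δ es ↭-refl) ⟩
  suc (length (indices es))           ≡⟨ cong suc (Listₚ.length-map index es) ⟩
  suc (length es)                     ∎
  where open ≡-Reasoning

indices-build : ∀ rs → odd? (length rs) ≡ false → indices (build rs) ↭ rs
indices-build []           _    = ↭-refl
indices-build (a ∷ c ∷ rs) even =
  indices-insertAt a D _ _ (indices-insertAt c U _ _ (indices-build rs even))

fresh : ∀ {r xs} es → indices es ↭ xs → All (r ≢_) xs → All (λ e → r ≢ index e) es
fresh es perm r∉xs = Allₚ.map⁻ (↭ₚ.All-resp-↭ (↭-sym perm) r∉xs)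

Ascending : ℕ → List Entry → Set
Ascending b []       = ⊤
Ascending b (e ∷ es) = b < index e × Ascending (index e) es

ascending⇒above : ∀ {b} es → Ascending b es → All (λ e → b < index e) es
ascending⇒above []       _          = []
ascending⇒above (e ∷ es) (b<e , asc) = b<e ∷ All.map (ℕₚ.<-trans b<e) (ascending⇒above es asc)

ascending-weaken : ∀ {b b′} es → b ≤ b′ → Ascending b′ es → Ascending b es
ascending-weaken []       _    _          = tt
ascending-weaken (e ∷ es) b≤b′ (b′<e , asc) = ℕₚ.≤-<-trans b≤b′ b′<e , asc

ascending-shiftUps : ∀ c {b} es → Ascending b es → Ascending b (map (shiftUps c) es)
ascending-shiftUps c []       _          = tt
ascending-shiftUps c (e ∷ es) (b<e , asc) = b<e , ascending-shiftUps c es asc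

ascending-around : ∀ {b} pre e post → Ascending b (pre ++ e ∷ post) →
                   All (λ x → index x < index e) pre × All (λ x → index e < index x) post
ascending-around []        e post (_ , asc) = [] , ascending⇒above post asc
ascending-around (x ∷ pre) e post (_ , asc) with ascending-around pre e post asc
... | below , above =
  All.head (Allₚ.++⁻ʳ pre (ascending⇒above (pre ++ e ∷ post) asc)) ∷ below , above

ascending-excise : ∀ δ {b} pre e post → Ascending b (pre ++ e ∷ post) → Ascending b (excise δ pre post)
ascending-excise δ []        e post (b<e , asc) =
  ascending-shiftUps (- δ) post (ascending-weaken post (ℕₚ.<⇒≤ b<e) asc)
ascending-excise δ (x ∷ pre) e post (b<x , asc) = b<x , ascending-excise δ pre e post asc

ascending-splice : ∀ δ {b} pre e post → Ascending b (pre ++ post) →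
                   All (λ x → index x < index e) pre → All (λ x → index e < index x) post →
                   b < index e →
                   Ascending b (splice δ pre e post)
ascending-splice δ []        e []         _           _             _         b<e = b<e , tt
ascending-splice δ []        e (x ∷ post) (_ , asc)   _             (e<x ∷ _) b<e =
  b<e , e<x , ascending-shiftUps δ post asc
ascending-splice δ (x ∷ pre) e post       (b<x , asc) (x<e ∷ below) above     _   =
  b<x , ascending-splice δ pre e post asc below above x<e

splitAround : ∀ r {b} es → Ascending b es → All (λ e → r ≢ index e) es →
  Σ (List Entry) λ A → Σ (List Entry) λ B →
    es ≡ A ++ B × All (λ x → index x < r) A × All (λ x → r < index x) B
splitAround r []       _          _          = [] , [] , refl , [] , []
splitAround r (e ∷ es) (_ , asc)  (r≢e ∷ fresh) with index e ℕ.<? r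
... | yes e<r with splitAround r es asc fresh
...   | A , B , refl , below , above = e ∷ A , B , refl , e<r ∷ below , above
splitAround r (e ∷ es) (_ , asc) (r≢e ∷ fresh) | no e≮r =
  [] , e ∷ es , refl , [] , r<e ∷ All.map (ℕₚ.<-trans r<e) (ascending⇒above es asc)
  where r<e = ℕₚ.≤∧≢⇒< (ℕₚ.≮⇒≥ e≮r) r≢e

shiftDowns-cancel : ∀ {c d} → c ℤ.+ d ≡ ℤ.0ℤ → ∀ es → map (shiftDowns d) (map (shiftDowns c) es) ≡ es
shiftDowns-cancel c+d≡0 [] = refl
shiftDowns-cancel c+d≡0 ((r , U , w) ∷ es) = cong (_ ∷_) (shiftDowns-cancel c+d≡0 es)
shiftDowns-cancel c+d≡0 ((r , D , w) ∷ es) =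
  cong₂ (λ w′ → (r , D , w′) ∷_) (+-cancel c+d≡0 w) (shiftDowns-cancel c+d≡0 es)

shiftUps-cancel : ∀ {c d} → c ℤ.+ d ≡ ℤ.0ℤ → ∀ es → map (shiftUps d) (map (shiftUps c) es) ≡ es
shiftUps-cancel c+d≡0 [] = refl
shiftUps-cancel c+d≡0 ((r , D , w) ∷ es) = cong (_ ∷_) (shiftUps-cancel c+d≡0 es)
shiftUps-cancel c+d≡0 ((r , U , w) ∷ es) =
  cong₂ (λ w′ → (r , U , w′) ∷_) (+-cancel c+d≡0 w) (shiftUps-cancel c+d≡0 es)

excise-splice : ∀ δ A B → excise δ (map (shiftDowns (- δ)) A) (map (shiftUps δ) B) ≡ A ++ B
excise-splice δ A B =
  cong₂ _++_ (shiftDowns-cancel (ℤₚ.+-inverseˡ δ) A) (shiftUps-cancel (ℤₚ.+-inverseʳ δ) B)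

insertAt-split : ∀ r s δ A B → All (λ x → index x < r) A → All (λ x → r < index x) B →
                 insertAt r s δ (A ++ B) ≡ splice δ A (r , s , + 0) B
insertAt-split r s δ []      []      _            _         = refl
insertAt-split r s δ []      (x ∷ B) _            (r<x ∷ _) rewrite <ℕ-false (ℕₚ.<-asym r<x) = refl
insertAt-split r s δ (x ∷ A) B       (x<r ∷ below) above    rewrite <ℕ-true x<r =
  cong (shiftDowns (- δ) x ∷_) (insertAt-split r s δ A B below above)

insertAt-excise : ∀ δ {b} pre r s post → Ascending b (pre ++ (r , s , + 0) ∷ post) →
                  insertAt r s δ (excise δ pre post) ≡ pre ++ (r , s , + 0) ∷ post
insertAt-excise δ pre r s post asc with ascending-around pre (r , s , + 0) post asc
... | below , above = begin
  insertAt r s δ (excise δ pre post)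
    ≡⟨ insertAt-split r s δ _ _ (Allₚ.map⁺ below) (Allₚ.map⁺ above) ⟩
  splice δ (map (shiftDowns δ) pre) (r , s , + 0) (map (shiftUps (- δ)) post)
    ≡⟨ cong₂ (λ A B → A ++ (r , s , + 0) ∷ B) (shiftDowns-cancel (ℤₚ.+-inverseʳ δ) pre)
                                              (shiftUps-cancel (ℤₚ.+-inverseˡ δ) post) ⟩
  pre ++ (r , s , + 0) ∷ post ∎
  where open ≡-Reasoning

contract-++ : ∀ k f xs ys → contract k f (xs ++ ys) ≡ contract k f xs ++ contract k f ys
contract-++ k f []                ys = refl
contract-++ k f ((j , e , h) ∷ xs) ys with ⌊ j ℕ.≟ k ⌋
... | true  = contract-++ k f xs ys
... | false = cong (f j e ∷_) (contract-++ k f xs ys)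

annotate-middle : ∀ y k pre e post → Σ ℤ λ h → Σ ℤ λ y′ →
  annotate y k (pre ++ e ∷ post) ≡
  annotate y k pre ++ (k ℕ.+ length pre , e , h) ∷ annotate y′ (suc (k ℕ.+ length pre)) post
annotate-middle y k [] (r , U , w) post rewrite ℕₚ.+-identityʳ k = _ , _ , refl
annotate-middle y k [] (r , D , w) post rewrite ℕₚ.+-identityʳ k = _ , _ , refl
annotate-middle y k ((r , U , w) ∷ pre) e post
  with h , y′ , eq ← annotate-middle (y ℤ.+ ℤ.1ℤ) (suc k) pre e post
  rewrite ℕₚ.+-suc k (length pre) = h , y′ , cong (_ ∷_) eq
annotate-middle y k ((r , D , w) ∷ pre) e post
  with h , y′ , eq ← annotate-middle (y ℤ.- ℤ.1ℤ) (suc k) pre e post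
  rewrite ℕₚ.+-suc k (length pre) = h , y′ , cong (_ ∷_) eq

annotate-miss : (q : AEntry → Bool) (q′ : Entry → Bool) → (∀ k e h → q (k , e , h) ≡ q′ e) →
                ∀ y k {es} → Miss q′ es → Miss q (annotate y k es)
annotate-miss q q′ q≡q′ y k {[]} [] = []
annotate-miss q q′ q≡q′ y k {(r , U , w) ∷ es} (miss ∷ misses) =
  trans (q≡q′ k _ y) miss ∷ annotate-miss q q′ q≡q′ _ _ misses
annotate-miss q q′ q≡q′ y k {(r , D , w) ∷ es} (miss ∷ misses) =
  trans (q≡q′ k _ _) miss ∷ annotate-miss q q′ q≡q′ _ _ misses

module _ {k n K : ℕ} (k+1+n≤K : k ℕ.+ suc n ≤ K) where

  head<K : k < K
  head<K = ℕₚ.<-≤-trans (ℕₚ.m<m+n k ℕₚ.0<1+n) k+1+n≤K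

  tail≤K : suc k ℕ.+ n ≤ K
  tail≤K = subst (_≤ K) (ℕₚ.+-suc k n) k+1+n≤K

module _ (K : ℕ) (cU cD : ℤ) where

  contract-left : ∀ y k xs → k ℕ.+ length xs ≤ K →
                  contract K (sidesBy K cU cD) (annotate y k xs) ≡ map (shiftDowns cD) xs
  contract-left y k [] _ = refl
  contract-left y k ((r , U , w) ∷ xs) k+n<K
    rewrite ≟-false (ℕₚ.<⇒≢ (head<K k+n<K)) | <ℕ-false (ℕₚ.<⇒≯ (head<K k+n<K))
    = cong (_ ∷_) (contract-left _ (suc k) xs (tail≤K k+n<K))
  contract-left y k ((r , D , w) ∷ xs) k+n<K
    rewrite ≟-false (ℕₚ.<⇒≢ (head<K k+n<K)) | <ℕ-true (head<K k+n<K)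
    = cong (_ ∷_) (contract-left _ (suc k) xs (tail≤K k+n<K))

  contract-right : ∀ y k xs → K < k →
                   contract K (sidesBy K cU cD) (annotate y k xs) ≡ map (shiftUps cU) xs
  contract-right y k [] _ = refl
  contract-right y k ((r , U , w) ∷ xs) K<k
    rewrite ≟-false (ℕₚ.>⇒≢ K<k) | <ℕ-true K<k
    = cong (_ ∷_) (contract-right _ (suc k) xs (ℕₚ.m<n⇒m<1+n K<k))
  contract-right y k ((r , D , w) ∷ xs) K<k
    rewrite ≟-false (ℕₚ.>⇒≢ K<k) | <ℕ-false (ℕₚ.<⇒≯ K<k)
    = cong (_ ∷_) (contract-right _ (suc k) xs (ℕₚ.m<n⇒m<1+n K<k))

contract-here : ∀ K f e h rest → contract K f ((K , e , h) ∷ rest) ≡ contract K f rest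
contract-here K f e h rest rewrite ≟-true K = refl

contract-at : ∀ δ pre e post → let K = length pre in
  contract K (sidesBy K (- δ) δ) (annotate (+ 0) 0 (pre ++ e ∷ post)) ≡ excise δ pre post
contract-at δ pre e post with h , y′ , eq ← annotate-middle (+ 0) 0 pre e post rewrite eq = begin
  contract K f (annotate (+ 0) 0 pre ++ (K , e , h) ∷ annotate y′ (suc K) post)
    ≡⟨ contract-++ K f (annotate (+ 0) 0 pre) _ ⟩
  contract K f (annotate (+ 0) 0 pre) ++ contract K f ((K , e , h) ∷ annotate y′ (suc K) post)
    ≡⟨ cong₂ _++_ (contract-left K (- δ) δ (+ 0) 0 pre ℕₚ.≤-refl)
                  (trans (contract-here K f e h (annotate y′ (suc K) post))
                         (contract-right K (- δ) δ y′ (suc K) post ℕₚ.≤-refl)) ⟩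
  excise δ pre post ∎
  where
  open ≡-Reasoning
  K = length pre
  f = sidesBy K (- δ) δ

firstZeroDown : ∀ pre r post → Miss isZeroDown pre → Σ ℤ λ h →
  findFirst downZero (annotate (+ 0) 0 (pre ++ (r , D , + 0) ∷ post))
    ≡ just (length pre , (r , D , + 0) , h)
firstZeroDown pre r post miss
  with h , y′ , eq ← annotate-middle (+ 0) 0 pre (r , D , + 0) post rewrite eq =
  h , findFirst-hit downZero (annotate (+ 0) 0 pre) _
        (annotate-miss downZero isZeroDown (λ _ _ _ → refl) _ _ miss) refl

lastZeroUp : ∀ pre r post → Miss isZeroUp post → Σ ℤ λ h →
  findFirst upZero (reverse (annotate (+ 0) 0 (pre ++ (r , U , + 0) ∷ post)))
    ≡ just (length pre , (r , U , + 0) , h)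
lastZeroUp pre r post miss
  with h , y′ , eq ← annotate-middle (+ 0) 0 pre (r , U , + 0) post
  rewrite eq | reverse-middle (annotate (+ 0) 0 pre) (length pre , (r , U , + 0) , h)
                             (annotate y′ (suc (length pre)) post) =
  h , findFirst-hit upZero (reverse (annotate y′ _ post)) _
        (All-reverse (annotate-miss upZero isZeroUp (λ _ _ _ → refl) _ _ miss)) refl

reflect : ℕ → ℕ → ℕ
reflect m r = m ∸ r ℕ.+ 1

letter : ℕ → ℕ → ℤ
letter m r = + reflect m r

ψStep-even : ∀ m pre r post → let es = pre ++ (r , D , + 0) ∷ post in
  Miss isZeroDown pre → odd? (length es) ≡ false →
  ψStep m es ≡ just (excise (- ℤ.1ℤ) pre post , letter m r)
ψStep-even m pre r post miss even with h , hit ← firstZeroDown pre r post miss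
  rewrite even | hit | contract-at (- ℤ.1ℤ) pre (r , D , + 0) post = refl

ψStep-odd : ∀ m pre r post → let es = pre ++ (r , U , + 0) ∷ post in
  Miss downAtHeight (annotate (+ 0) 0 es) → Miss isZeroUp post → odd? (length es) ≡ true →
  ψStep m es ≡ just (excise ℤ.1ℤ pre post , letter m r)
ψStep-odd m pre r post noDownAtHeight miss odd with h , hit ← lastZeroUp pre r post miss
  rewrite odd | findFirst-miss downAtHeight noDownAtHeight | hit | contract-at ℤ.1ℤ pre (r , U , + 0) post
  = refl

Ballot : ℕ → ℕ → ℕ → List Entry → Set
Ballot s h       e []                  = h ≡ e
Ballot s h       e ((_ , U , w) ∷ es) = (∃ λ n → w ≡ + n × n ≤ h) × Ballot s (suc h) e es
Ballot s zero    e ((_ , D , w) ∷ es) = ⊥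
Ballot s (suc h) e ((_ , D , w) ∷ es) = (∃ λ n → w ≡ + n × s ℕ.+ n ≤ h) × Ballot s h e es

ballot-++⁻ : ∀ s h e xs ys → Ballot s h e (xs ++ ys) → Σ ℕ λ k → Ballot s h k xs × Ballot s k e ys
ballot-++⁻ s h       e []                  ys bal       = h , refl , bal
ballot-++⁻ s h       e ((_ , U , _) ∷ xs) ys (w≤ , bal)
  with k , bal₁ , bal₂ ← ballot-++⁻ s (suc h) e xs ys bal = k , (w≤ , bal₁) , bal₂
ballot-++⁻ s (suc h) e ((_ , D , _) ∷ xs) ys (w≤ , bal)
  with k , bal₁ , bal₂ ← ballot-++⁻ s h e xs ys bal = k , (w≤ , bal₁) , bal₂

ballot-++⁺ : ∀ s h k e xs ys → Ballot s h k xs → Ballot s k e ys → Ballot s h e (xs ++ ys)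
ballot-++⁺ s h       k e []                  ys refl       bal₂ = bal₂
ballot-++⁺ s h       k e ((_ , U , _) ∷ xs) ys (w≤ , bal₁) bal₂ =
  w≤ , ballot-++⁺ s (suc h) k e xs ys bal₁ bal₂
ballot-++⁺ s (suc h) k e ((_ , D , _) ∷ xs) ys (w≤ , bal₁) bal₂ =
  w≤ , ballot-++⁺ s h k e xs ys bal₁ bal₂

ballot-lowerDowns : ∀ h k A → Ballot 0 h k A → Miss isZeroDown A →
                    Ballot 1 h k (map (shiftDowns (- ℤ.1ℤ)) A)
ballot-lowerDowns h       k []                  bal                       _           = bal
ballot-lowerDowns h       k ((_ , U , _) ∷ A) (w≤ , bal)                (_ ∷ miss)  =
  w≤ , ballot-lowerDowns (suc h) k A bal miss
ballot-lowerDowns (suc h) k ((_ , D , _) ∷ A) ((zero , refl , _) , bal)  (() ∷ _)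
ballot-lowerDowns (suc h) k ((_ , D , _) ∷ A) ((suc n , refl , n<h) , bal) (_ ∷ miss) =
  (n , refl , n<h) , ballot-lowerDowns h k A bal miss

ballot-raiseDowns : ∀ h k A → Ballot 1 h k A → Ballot 0 h k (map (shiftDowns ℤ.1ℤ) A)
ballot-raiseDowns h       k []                  bal                   = bal
ballot-raiseDowns h       k ((_ , U , _) ∷ A) (w≤ , bal)            =
  w≤ , ballot-raiseDowns (suc h) k A bal
ballot-raiseDowns (suc h) k ((_ , D , _) ∷ A) ((n , refl , n<h) , bal) =
  (n ℕ.+ 1 , refl , subst (_≤ h) (ℕₚ.+-comm 1 n) n<h) , ballot-raiseDowns h k A bal

ballot-raiseUps : ∀ h k B → Ballot 0 h k B → Ballot 1 (suc h) (suc k) (map (shiftUps ℤ.1ℤ) B)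
ballot-raiseUps h       k []                  refl                  = refl
ballot-raiseUps h       k ((_ , U , _) ∷ B) ((n , refl , n≤h) , bal) =
  (n ℕ.+ 1 , refl , subst (_≤ suc h) (ℕₚ.+-comm 1 n) (s≤s n≤h)) , ballot-raiseUps (suc h) k B bal
ballot-raiseUps (suc h) k ((_ , D , _) ∷ B) ((n , refl , n≤h) , bal) =
  (n , refl , s≤s n≤h) , ballot-raiseUps h k B bal

ballot-lowerUps : ∀ h k B → Ballot 1 (suc h) (suc k) B → Miss isZeroUp B →
                  Ballot 0 h k (map (shiftUps (- ℤ.1ℤ)) B)
ballot-lowerUps h       k []                  refl                          _          = refl
ballot-lowerUps h       k ((_ , U , _) ∷ B) ((zero , refl , _) , bal)      (() ∷ _)
ballot-lowerUps h       k ((_ , U , _) ∷ B) ((suc n , refl , s≤s n≤h) , bal) (_ ∷ miss) =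
  (n , refl , n≤h) , ballot-lowerUps (suc h) k B bal miss
ballot-lowerUps zero    k ((_ , D , _) ∷ B) ((n , refl , ()) , bal)        _
ballot-lowerUps (suc h) k ((_ , D , _) ∷ B) ((n , refl , s≤s n≤h) , bal)   (_ ∷ miss) =
  (n , refl , n≤h) , ballot-lowerUps h k B bal miss

ballot-excise-even : ∀ pre e post → Ballot 0 0 0 (pre ++ (e , D , + 0) ∷ post) → Miss isZeroDown pre →
                     Ballot 1 0 1 (excise (- ℤ.1ℤ) pre post)
ballot-excise-even pre e post bal miss with ballot-++⁻ 0 0 0 pre _ bal
... | suc k , bal₁ , (_ , bal₂) =
  ballot-++⁺ 1 0 (suc k) 1 _ _ (ballot-lowerDowns 0 (suc k) pre bal₁ miss)
                               (ballot-raiseUps k 0 post bal₂)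

ballot-excise-odd : ∀ pre e post → Ballot 1 0 1 (pre ++ (e , U , + 0) ∷ post) → Miss isZeroUp post →
                    Ballot 0 0 0 (excise ℤ.1ℤ pre post)
ballot-excise-odd pre e post bal miss with k , bal₁ , (_ , bal₂) ← ballot-++⁻ 1 0 1 pre _ bal =
  ballot-++⁺ 0 0 k 0 _ _ (ballot-raiseDowns 0 k pre bal₁) (ballot-lowerUps k 0 post bal₂ miss)

ballot-fromGround : ∀ s e es → Ballot s 0 (suc e) es → Miss isZeroUp es → ⊥
ballot-fromGround s e ((_ , U , _) ∷ _) ((zero , refl , _) , _) (() ∷ _)

ballot-splice-even : ∀ A e B → Ballot 1 0 1 (A ++ B) → Miss isZeroUp B →
                     Ballot 0 0 0 (splice (- ℤ.1ℤ) A (e , D , + 0) B)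
ballot-splice-even A e B bal miss with ballot-++⁻ 1 0 1 A B bal
... | zero  , _    , bal₂ = ⊥-elim (ballot-fromGround 1 0 B bal₂ miss)
... | suc k , bal₁ , bal₂ =
  ballot-++⁺ 0 0 (suc k) 0 _ _ (ballot-raiseDowns 0 (suc k) A bal₁)
                               ((0 , refl , z≤n) , ballot-lowerUps k 0 B bal₂ miss)

ballot-splice-odd : ∀ A e B → Ballot 0 0 0 (A ++ B) → Miss isZeroDown A →
                    Ballot 1 0 1 (splice ℤ.1ℤ A (e , U , + 0) B)
ballot-splice-odd A e B bal miss with k , bal₁ , bal₂ ← ballot-++⁻ 0 0 0 A B bal =
  ballot-++⁺ 1 0 k 1 _ _ (ballot-lowerDowns 0 k A bal₁ miss)
                         ((0 , refl , z≤n) , ballot-raiseUps k 0 B bal₂)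

-- a down step without label 0 ends at positive height, as its label is at most that height
ballot-noZeroDown-end : ∀ h e x es → Ballot 0 h e (x ∷ es) → Miss isZeroDown (x ∷ es) → 0 < e
ballot-noZeroDown-end h       e (_ , U , _) []       (_ , refl)                    _ = s≤s z≤n
ballot-noZeroDown-end (suc h) e (_ , D , _) []       ((zero , refl , _) , refl)    (() ∷ _)
ballot-noZeroDown-end (suc h) e (_ , D , _) []       ((suc n , refl , n<h) , refl) _ =
  ℕₚ.≤-trans (s≤s z≤n) n<h
ballot-noZeroDown-end h       e (_ , U , _) (y ∷ es) (_ , bal) (_ ∷ miss) =
  ballot-noZeroDown-end (suc h) e y es bal miss
ballot-noZeroDown-end (suc h) e (_ , D , _) (y ∷ es) (_ , bal) (_ ∷ miss) =
  ballot-noZeroDown-end h e y es bal miss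

dyck-noZeroDown : ∀ es → Ballot 0 0 0 es → Miss isZeroDown es → es ≡ []
dyck-noZeroDown []       _   _    = refl
dyck-noZeroDown (x ∷ xs) bal miss = ⊥-elim (ℕₚ.<-irrefl refl (ballot-noZeroDown-end 0 0 x xs bal miss))

ballot-parity : ∀ s h e es → Ballot s h e es → odd? (length es ℕ.+ h) ≡ odd? e
ballot-parity s h       e []                  refl      = refl
ballot-parity s h       e ((_ , U , _) ∷ es) (_ , bal)
  rewrite sym (ℕₚ.+-suc (length es) h) = ballot-parity s (suc h) e es bal
ballot-parity s (suc h) e ((_ , D , _) ∷ es) (_ , bal)
  rewrite ℕₚ.+-suc (length es) h = ballot-parity s h e es bal

ballot-length-parity : ∀ s e es → Ballot s 0 e es → odd? (length es) ≡ odd? e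
ballot-length-parity s e es bal =
  trans (cong odd? (sym (ℕₚ.+-identityʳ (length es)))) (ballot-parity s 0 e es bal)

ballot-noDownAtHeight : ∀ h e k es → Ballot 1 h e es → Miss downAtHeight (annotate (+ h) k es)
ballot-noDownAtHeight h       e k []                 _ = []
ballot-noDownAtHeight h       e k ((_ , U , _) ∷ es) (_ , bal)
  rewrite ℤₚ.+-comm (+ h) ℤ.1ℤ = refl ∷ ballot-noDownAtHeight (suc h) e (suc k) es bal
ballot-noDownAtHeight (suc h) e k ((_ , D , _) ∷ es) ((n , refl , n<h) , bal) =
  ==ℤ-false (ℕₚ.<⇒≢ n<h) ∷ ballot-noDownAtHeight h e (suc k) es bal

ballot-natural : ∀ s h e es → Ballot s h e es → All Natural es
ballot-natural s h       e []                 _                = []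
ballot-natural s h       e ((_ , U , _) ∷ es) ((n , w≡n , _) , bal) =
  (n , w≡n) ∷ ballot-natural s (suc h) e es bal
ballot-natural s (suc h) e ((_ , D , _) ∷ es) ((n , w≡n , _) , bal) =
  (n , w≡n) ∷ ballot-natural s h e es bal

raiseUps-noZeroUp : ∀ {es} → All Natural es → Miss isZeroUp (map (shiftUps ℤ.1ℤ) es)
raiseUps-noZeroUp {[]}              []                = []
raiseUps-noZeroUp {(_ , U , _) ∷ _} ((n , refl) ∷ nats) =
  ==ℤ-false (ℕₚ.m+1+n≢0 n {0}) ∷ raiseUps-noZeroUp nats
raiseUps-noZeroUp {(_ , D , _) ∷ _} (_ ∷ nats)          = refl ∷ raiseUps-noZeroUp nats

raiseDowns-noZeroDown : ∀ {es} → All Natural es → Miss isZeroDown (map (shiftDowns ℤ.1ℤ) es)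
raiseDowns-noZeroDown {[]}              []                = []
raiseDowns-noZeroDown {(_ , U , _) ∷ _} (_ ∷ nats)          = refl ∷ raiseDowns-noZeroDown nats
raiseDowns-noZeroDown {(_ , D , _) ∷ _} ((n , refl) ∷ nats) =
  ==ℤ-false (ℕₚ.m+1+n≢0 n {0}) ∷ raiseDowns-noZeroDown nats

-- The configurations before an even and before an odd stage; b is the original index of the
-- step contracted at the previous stage.
record EvenState (b : ℕ) (es : List Entry) : Set where
  constructor evenState
  field
    ballot         : Ballot 0 0 0 es
    ascending      : Ascending 0 es
    zeroDownsAbove : All (Guarded isZeroDown λ e → b < index e) es

record OddState (b : ℕ) (es : List Entry) : Set where
  constructor oddState
  field
    ballot       : Ballot 1 0 1 es
    ascending    : Ascending 0 es
    zeroUpsBelow : All (Guarded isZeroUp λ e → index e < b) es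

evenStage : ∀ {b es} → EvenState b es → es ≡ [] ⊎
  Σ ℕ λ a → Σ (List Entry) λ es′ → b < a × OddState a es′ × insertDown a es′ ≡ es
evenStage {b} {es} (evenState bal asc zeroDowns) with firstHit? isZeroDown es
... | inj₁ miss = inj₁ (dyck-noZeroDown es bal miss)
... | inj₂ (pre , (a , s , w) , post , refl , miss , hit) with isZeroDown-hit {a} {s} {w} hit
... | refl , refl =
  inj₂ (a , excise (- ℤ.1ℤ) pre post , All.head (Allₚ.++⁻ʳ pre zeroDowns) refl ,
        oddState (ballot-excise-even pre a post bal miss) (ascending-excise (- ℤ.1ℤ) pre _ post asc)
                 zeroUps ,
        insertAt-excise (- ℤ.1ℤ) pre a D post asc)
  where
  below = proj₁ (ascending-around pre (a , D , + 0) post asc)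
  nats  = All.tail (Allₚ.++⁻ʳ pre (ballot-natural 0 0 0 _ bal))
  zeroUps : All (Guarded isZeroUp λ e → index e < a) (excise (- ℤ.1ℤ) pre post)
  zeroUps = Allₚ.++⁺ (Allₚ.map⁺ (All.map (λ x<a _ → x<a) below))
                     (guard-miss isZeroUp (raiseUps-noZeroUp nats))

oddStage : ∀ {b es} → OddState b es →
  Σ ℕ λ c → Σ (List Entry) λ es′ → c < b × EvenState c es′ × insertUp c es′ ≡ es
oddStage {b} {es} (oddState bal asc zeroUps) with lastHit? isZeroUp es
... | inj₁ miss = ⊥-elim (ballot-fromGround 1 0 es bal miss)
... | inj₂ (pre , (c , s , w) , post , refl , hit , miss) with isZeroUp-hit {c} {s} {w} hit
... | refl , refl =
  c , excise ℤ.1ℤ pre post , All.head (Allₚ.++⁻ʳ pre zeroUps) refl ,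
  evenState (ballot-excise-odd pre c post bal miss) (ascending-excise ℤ.1ℤ pre _ post asc) zeroDowns ,
  insertAt-excise ℤ.1ℤ pre c U post asc
  where
  above = proj₂ (ascending-around pre (c , U , + 0) post asc)
  nats  = Allₚ.++⁻ˡ pre (ballot-natural 1 0 1 _ bal)
  zeroDowns : All (Guarded isZeroDown λ e → c < index e) (excise ℤ.1ℤ pre post)
  zeroDowns = Allₚ.++⁺ (guard-miss isZeroDown (raiseDowns-noZeroDown nats))
                       (Allₚ.map⁺ (All.map (λ c<x _ → c<x) above))

insertDown-stage : ∀ m {b a es} → OddState a es → All (λ e → a ≢ index e) es → b < a →
  EvenState b (insertDown a es) × ψStep m (insertDown a es) ≡ just (es , letter m a)
insertDown-stage m {b} {a} {es} (oddState bal asc zeroUps) fresh b<a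
  with A , B , refl , below , above ← splitAround a es asc fresh
  rewrite insertAt-split a D (- ℤ.1ℤ) A B below above =
  evenState bal′ (ascending-splice (- ℤ.1ℤ) A (a , D , + 0) B asc below above (ℕₚ.≤-<-trans z≤n b<a))
            zeroDowns ,
  trans (ψStep-even m _ a _ missA (ballot-length-parity 0 0 _ bal′))
        (cong (λ es → just (es , _)) (excise-splice (- ℤ.1ℤ) A B))
  where
  missB : Miss isZeroUp B
  missB = guarded⇒miss isZeroUp (Allₚ.++⁻ʳ A zeroUps) (All.map (λ a<x x<a → ℕₚ.<-asym a<x x<a) above)
  missA : Miss isZeroDown (map (shiftDowns ℤ.1ℤ) A)
  missA = raiseDowns-noZeroDown (Allₚ.++⁻ˡ A (ballot-natural 1 0 1 _ bal))
  bal′ = ballot-splice-even A a B bal missB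
  zeroDowns : All (Guarded isZeroDown λ e → b < index e) (splice (- ℤ.1ℤ) A (a , D , + 0) B)
  zeroDowns = Allₚ.++⁺ (guard-miss isZeroDown missA)
                       ((λ _ → b<a) ∷ Allₚ.map⁺ (All.map (λ a<x _ → ℕₚ.<-trans b<a a<x) above))

insertUp-stage : ∀ m {b c es} → EvenState c es → All (λ e → c ≢ index e) es → 0 < c → c < b →
  OddState b (insertUp c es) × ψStep m (insertUp c es) ≡ just (es , letter m c)
insertUp-stage m {b} {c} {es} (evenState bal asc zeroDowns) fresh 0<c c<b
  with A , B , refl , below , above ← splitAround c es asc fresh
  rewrite insertAt-split c U ℤ.1ℤ A B below above =
  oddState bal′ (ascending-splice ℤ.1ℤ A (c , U , + 0) B asc below above 0<c) zeroUps ,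
  trans (ψStep-odd m _ c _ (ballot-noDownAtHeight 0 1 0 _ bal′) missB (ballot-length-parity 1 1 _ bal′))
        (cong (λ es → just (es , _)) (excise-splice ℤ.1ℤ A B))
  where
  missA : Miss isZeroDown A
  missA = guarded⇒miss isZeroDown (Allₚ.++⁻ˡ A zeroDowns)
                       (All.map (λ x<c c<x → ℕₚ.<-asym x<c c<x) below)
  missB : Miss isZeroUp (map (shiftUps ℤ.1ℤ) B)
  missB = raiseUps-noZeroUp (Allₚ.++⁻ʳ A (ballot-natural 0 0 0 _ bal))
  bal′ = ballot-splice-odd A c B bal missA
  zeroUps : All (Guarded isZeroUp λ e → index e < b) (splice ℤ.1ℤ A (c , U , + 0) B)
  zeroUps = Allₚ.++⁺ (Allₚ.map⁺ (All.map (λ x<c _ → ℕₚ.<-trans x<c c<b) below))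
                     ((λ _ → c<b) ∷ guard-miss isZeroUp missB)

decompose : ∀ {b} es → Acc _<_ (length es) → EvenState b es →
  Σ (List ℕ) λ rs → Up (b ∷ rs) × odd? (length rs) ≡ false × build rs ≡ es
decompose es (acc shorter) st with evenStage st
... | inj₁ refl = [] , tt , refl , refl
... | inj₂ (a , es′ , b<a , st′ , refl) with oddStage st′
... | c , es″ , c<a , st″ , refl with decompose es″ (shorter es″<es) st″
  where
  es″<es : length es″ < length (insertDown a (insertUp c es″))
  es″<es = subst (length es″ <_)
                 (sym (trans (length-insertAt a D (- ℤ.1ℤ) (insertUp c es″))
                             (cong suc (length-insertAt c U ℤ.1ℤ es″))))
                 (ℕₚ.m<n⇒m<1+n ℕₚ.≤-refl)
... | rs , up , even , refl = a ∷ c ∷ rs , (b<a , c<a , up) , even , refl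

buildRun : ∀ m {b} rs → Up (b ∷ rs) → odd? (length rs) ≡ false → Unique rs → All (0 <_) rs →
  EvenState b (build rs) ×
  (∀ out → ψRun m (length rs) (build rs) out ≡ just (map (letter m) rs ʳ++ out))
buildRun m []           _                _    _ _ = evenState refl tt [] , λ _ → refl
buildRun m (a ∷ c ∷ rs) (b<a , c<a , up) even ((a≢c ∷ a∉rs) ∷ c∉rs ∷ unique) (_ ∷ 0<c ∷ pos)
  with st , run ← buildRun m rs up even unique pos
  with stUp , stepUp ← insertUp-stage m st (fresh _ (indices-build rs even) c∉rs) 0<c c<a
  with stDown , stepDown ←
         insertDown-stage m stUp (fresh _ (indices-insertAt c U _ _ (indices-build rs even)) (a≢c ∷ a∉rs)) b<a =
  stDown , runs
  where
  runs : ∀ out → ψRun m (length (a ∷ c ∷ rs)) (build (a ∷ c ∷ rs)) out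
                 ≡ just (map (letter m) (a ∷ c ∷ rs) ʳ++ out)
  runs out rewrite stepDown | stepUp = run _

-- Ψ prepends each new letter, so contracting the original indices rs in this order writes
-- the word unsigned (Γ m rs)
Γ : ℕ → List ℕ → List ℕ
Γ m rs = reverse (map (reflect m) rs)

InRange : ℕ → ℕ → Set
InRange m x = 1 ≤ x × x ≤ m

isPerm-length : ∀ {m xs} → IsPerm m xs → length xs ≡ m
isPerm-length {m} perm = trans (↭ₚ.↭-length perm) (Listₚ.length-applyUpTo suc m)

isPerm-inRange : ∀ {m xs} → IsPerm m xs → All (InRange m) xs
isPerm-inRange {m} perm = ↭ₚ.All-resp-↭ (↭-sym perm) (Allₚ.applyUpTo⁺₁ suc m (λ i<m → s≤s z≤n , i<m))

isPerm-unique : ∀ {m xs} → IsPerm m xs → Unique xs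
isPerm-unique {m} perm = Setoid↭ₚ.Unique-resp-↭ (setoid ℕ) (↭⇒↭ₛ (↭-sym perm))
  (Uniqueₚ.applyUpTo⁺₁ suc m (λ i<j _ → ℕₚ.<⇒≢ (s≤s i<j)))

reflect-suc : ∀ k y → reflect (suc k) (suc y) ≡ suc (k ∸ y)
reflect-suc k y = ℕₚ.+-comm (k ∸ y) 1

reflect-involutive : ∀ {m x} → InRange m x → reflect m (reflect m x) ≡ x
reflect-involutive {suc k} {suc y} (_ , s≤s y≤k) = begin
  reflect (suc k) (reflect (suc k) (suc y)) ≡⟨ cong (reflect (suc k)) (reflect-suc k y) ⟩
  reflect (suc k) (suc (k ∸ y))             ≡⟨ reflect-suc k (k ∸ y) ⟩
  suc (k ∸ (k ∸ y))                         ≡⟨ cong suc (ℕₚ.m∸[m∸n]≡n y≤k) ⟩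
  suc y                                     ∎
  where open ≡-Reasoning

reflect-antitone : ∀ {m x y} → x ≤ m → y < x → reflect m x < reflect m y
reflect-antitone x≤m y<x = ℕₚ.+-monoˡ-< 1 (ℕₚ.∸-monoʳ-< y<x x≤m)

applyUpTo-∸ : ∀ m → applyUpTo (m ∸_) m ≡ applyDownFrom suc m
applyUpTo-∸ zero    = refl
applyUpTo-∸ (suc m) = cong (suc m ∷_) (applyUpTo-∸ m)

map-reflect-upTo : ∀ m → map (reflect m) (applyUpTo suc m) ↭ applyUpTo suc m
map-reflect-upTo m = ↭-trans (↭-reflexive reflected) (↭ₚ.↭-reverse (applyUpTo suc m))
  where
  open ≡-Reasoning
  reflect-suc∸ : ∀ {i} → i < m → reflect m (suc i) ≡ m ∸ i
  reflect-suc∸ {i} (s≤s i≤k) = trans (reflect-suc _ i) (sym (ℕₚ.+-∸-assoc 1 i≤k))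
  reflected : map (reflect m) (applyUpTo suc m) ≡ reverse (applyUpTo suc m)
  reflected = begin
    map (reflect m) (applyUpTo suc m)   ≡⟨ Listₚ.map-applyUpTo suc (reflect m) m ⟩
    applyUpTo (reflect m ∘ suc) m       ≡⟨ Listₚ.map-upTo (reflect m ∘ suc) m ⟨
    map (reflect m ∘ suc) (upTo m)      ≡⟨ Listₚ.map-cong-local (Allₚ.applyUpTo⁺₁ _ m reflect-suc∸) ⟩
    map (m ∸_) (upTo m)                 ≡⟨ Listₚ.map-upTo (m ∸_) m ⟩
    applyUpTo (m ∸_) m                  ≡⟨ applyUpTo-∸ m ⟩
    applyDownFrom suc m                 ≡⟨ Listₚ.reverse-applyUpTo suc m ⟨
    reverse (applyUpTo suc m)           ∎

Γ-isPerm : ∀ {m xs} → IsPerm m xs → IsPerm m (Γ m xs)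
Γ-isPerm {m} {xs} perm =
  ↭-trans (↭ₚ.↭-reverse (map (reflect m) xs)) (↭-trans (↭ₚ.map⁺ (reflect m) perm) (map-reflect-upTo m))

Γ-involutive : ∀ {m xs} → IsPerm m xs → Γ m (Γ m xs) ≡ xs
Γ-involutive {m} {xs} perm = begin
  reverse (map f (reverse (map f xs))) ≡⟨ cong reverse (Listₚ.reverse-map f (map f xs)) ⟩
  reverse (reverse (map f (map f xs))) ≡⟨ Listₚ.reverse-involutive (map f (map f xs)) ⟩
  map f (map f xs)                     ≡⟨ Listₚ.map-∘ xs ⟨
  map (f ∘ f) xs                       ≡⟨ Listₚ.map-id-local involutive ⟩
  xs                                   ∎
  where
  open ≡-Reasoning
  f = reflect m
  involutive = All.map reflect-involutive (isPerm-inRange perm)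

module _ (m : ℕ) where

  mutual
    reflect-Down : ∀ xs → All (_≤ m) xs → Down xs → Up (map (reflect m) xs)
    reflect-Down []           _                 _           = tt
    reflect-Down (x ∷ [])     _                 _           = tt
    reflect-Down (x ∷ y ∷ xs) (x≤m ∷ y≤m ∷ ≤m) (y<x , up) =
      reflect-antitone x≤m y<x , reflect-Up (y ∷ xs) (y≤m ∷ ≤m) up

    reflect-Up : ∀ xs → All (_≤ m) xs → Up xs → Down (map (reflect m) xs)
    reflect-Up []           _                 _           = tt
    reflect-Up (x ∷ [])     _                 _           = tt
    reflect-Up (x ∷ y ∷ xs) (x≤m ∷ y≤m ∷ ≤m) (x<y , down) =
      reflect-antitone y≤m x<y , reflect-Down (y ∷ xs) (y≤m ∷ ≤m) down

Down-ʳ++ : ∀ y xs T → Down (y ∷ xs) → Down (y ∷ T) → odd? (length xs) ≡ false → Down (xs ʳ++ y ∷ T)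
Down-ʳ++ y []           T _                    downT _    = downT
Down-ʳ++ y (z ∷ w ∷ xs) T (y>z , z<w , downXs) downT even =
  Down-ʳ++ w xs (z ∷ y ∷ T) downXs (z<w , y>z , downT) even

Up-reverse : ∀ xs → Up xs → odd? (length xs) ≡ false → Down (reverse xs)
Up-reverse []           _             _    = tt
Up-reverse (x ∷ y ∷ xs) (x<y , downY) even = Down-ʳ++ y xs (x ∷ []) downY (x<y , tt) even

Γ-Down : ∀ {m xs} → IsPerm m xs → odd? m ≡ false → Down xs → Down (Γ m xs)
Γ-Down {m} {xs} perm even down =
  Up-reverse (map (reflect m) xs) (reflect-Down m xs (All.map proj₂ (isPerm-inRange perm)) down)
    (trans (cong odd? (trans (Listₚ.length-map (reflect m) xs) (isPerm-length perm))) even)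

Up-fromZero : ∀ xs → All (0 <_) xs → Down xs → Up (0 ∷ xs)
Up-fromZero []       _         _    = tt
Up-fromZero (x ∷ xs) (0<x ∷ _) down = 0<x , down

odd?-double : ∀ n → odd? (2 * n) ≡ false
odd?-double zero    = refl
odd?-double (suc n) rewrite ℕₚ.*-suc 2 n = odd?-double n

unsigned-map : ∀ xs → unsigned xs ≡ map +_ xs
unsigned-map []       = refl
unsigned-map (x ∷ xs) = cong (+ x ∷_) (unsigned-map xs)

unsigned-injective : ∀ {xs ys} → unsigned xs ≡ unsigned ys → xs ≡ ys
unsigned-injective {xs} {ys} eq =
  Listₚ.map-injective ℤₚ.+-injective (trans (sym (unsigned-map xs)) (trans eq (unsigned-map ys)))

unsigned-Γ : ∀ m rs → map (letter m) rs ʳ++ [] ≡ unsigned (Γ m rs)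
unsigned-Γ m rs = begin
  reverse (map (+_ ∘ reflect m) rs)      ≡⟨ cong reverse (Listₚ.map-∘ rs) ⟩
  reverse (map +_ (map (reflect m) rs))  ≡⟨ Listₚ.reverse-map +_ (map (reflect m) rs) ⟨
  map +_ (Γ m rs)                        ≡⟨ unsigned-map (Γ m rs) ⟨
  unsigned (Γ m rs)                      ∎
  where open ≡-Reasoning

Up⇒Down-tail : ∀ b xs → Up (b ∷ xs) → Down xs
Up⇒Down-tail b []       _         = tt
Up⇒Down-tail b (x ∷ xs) (_ , down) = down

Γ-injective : ∀ {m xs ys} → IsPerm m xs → IsPerm m ys → Γ m xs ≡ Γ m ys → xs ≡ ys
Γ-injective {m} {xs} {ys} perm perm′ eq = begin
  xs             ≡⟨ Γ-involutive perm ⟨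
  Γ m (Γ m xs)   ≡⟨ cong (Γ m) eq ⟩
  Γ m (Γ m ys)   ≡⟨ Γ-involutive perm′ ⟩
  ys             ∎
  where open ≡-Reasoning

strip : List Entry → LPath
strip = map λ (_ , s , w) → s , ℤ.∣ w ∣

strip-initEntries : ∀ k L → strip (initEntries k L) ≡ L
strip-initEntries k []      = refl
strip-initEntries k (x ∷ L) = cong (x ∷_) (strip-initEntries (suc k) L)

LB⇒Ballot : ∀ h e k L → LB h e L → Ballot 0 h e (initEntries k L)
LB⇒Ballot h       e k []            lb         = lb
LB⇒Ballot h       e k ((U , w) ∷ L) (w≤ , lb) = (w , refl , w≤) , LB⇒Ballot (suc h) e (suc k) L lb
LB⇒Ballot (suc h) e k ((D , w) ∷ L) (w≤ , lb) = (w , refl , w≤) , LB⇒Ballot h e (suc k) L lb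

Ballot⇒LB : ∀ h e es → Ballot 0 h e es → LB h e (strip es)
Ballot⇒LB h       e []                  bal                    = bal
Ballot⇒LB h       e ((_ , U , _) ∷ es) ((_ , refl , w≤) , bal) = w≤ , Ballot⇒LB (suc h) e es bal
Ballot⇒LB (suc h) e ((_ , D , _) ∷ es) ((_ , refl , w≤) , bal) = w≤ , Ballot⇒LB h e es bal

ascending-initEntries : ∀ b k L → b < k → Ascending b (initEntries k L)
ascending-initEntries b k []      _   = tt
ascending-initEntries b k (_ ∷ L) b<k = b<k , ascending-initEntries k (suc k) L ℕₚ.≤-refl

indices-initEntries : ∀ k L (f : ℕ → ℕ) → (∀ i → f i ≡ k ℕ.+ i) →
                      indices (initEntries k L) ≡ applyUpTo f (length L)
indices-initEntries k []      f f≗ = refl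
indices-initEntries k (_ ∷ L) f f≗ = cong₂ _∷_ (sym (trans (f≗ 0) (ℕₚ.+-identityʳ k)))
  (indices-initEntries (suc k) L (f ∘ suc) (λ i → trans (f≗ (suc i)) (ℕₚ.+-suc k i)))

initEntries-evenState : ∀ L → LB 0 0 L → EvenState 0 (initEntries 1 L)
initEntries-evenState L lb = evenState (LB⇒Ballot 0 0 1 L lb) asc
  (All.map (λ 0<r _ → 0<r) (ascending⇒above (initEntries 1 L) asc))
  where asc = ascending-initEntries 0 1 L ℕₚ.≤-refl

ascending-count : ∀ {t} e es → Ascending (index e) es → All (λ x → index x ≤ t) (e ∷ es) →
                  index e ℕ.+ length es ≤ t
ascending-count e []       _           (e≤t ∷ []) = subst (_≤ _) (sym (ℕₚ.+-identityʳ (index e))) e≤t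
ascending-count {t} e (x ∷ es) (e<x , asc) (_ ∷ ≤t) = begin
  index e ℕ.+ suc (length es) ≡⟨ ℕₚ.+-suc (index e) (length es) ⟩
  suc (index e ℕ.+ length es) ≤⟨ ℕₚ.+-monoˡ-≤ (length es) e<x ⟩
  index x ℕ.+ length es       ≤⟨ ascending-count x es asc ≤t ⟩
  t                           ∎
  where open ℕₚ.≤-Reasoning

ascending-head : ∀ k e es → k < index e → Ascending (index e) es →
                 All (λ x → index x ≤ k ℕ.+ suc (length es)) (e ∷ es) → index e ≡ suc k
ascending-head k e es k<e asc bounded =
  ℕₚ.≤-antisym (ℕₚ.+-cancelʳ-≤ (length es) (index e) (suc k) e+n≤) k<e
  where
  e+n≤ : index e ℕ.+ length es ≤ suc k ℕ.+ length es
  e+n≤ = subst (index e ℕ.+ length es ≤_) (ℕₚ.+-suc k (length es)) (ascending-count e es asc bounded)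

initEntries-strip : ∀ k es → Ascending k es → All (λ x → index x ≤ k ℕ.+ length es) es →
                    All Natural es → initEntries (suc k) (strip es) ≡ es
initEntries-strip k [] _ _ _ = refl
initEntries-strip k ((r , s , _) ∷ es) (k<r , asc) bounded ((n , refl) ∷ nats)
  with refl ← ascending-head k (r , s , + n) es k<r asc bounded
  = cong (_ ∷_) (initEntries-strip (suc k) es asc bounded′ nats)
  where
  bounded′ = subst (λ t → All (λ x → index x ≤ t) es) (ℕₚ.+-suc k (length es)) (All.tail bounded)

ψRun-build : ∀ m rs → Up (0 ∷ rs) → odd? m ≡ false → IsPerm m rs →
  EvenState 0 (build rs) × ψRun m m (build rs) [] ≡ just (unsigned (Γ m rs))
ψRun-build m rs up even perm =
  let len = isPerm-length perm
      st , run = buildRun m rs up (trans (cong odd? len) even) (isPerm-unique perm)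
                          (All.map proj₁ (isPerm-inRange perm))
  in st , trans (cong (λ i → ψRun m i (build rs) []) (sym len))
                (trans (run []) (cong just (unsigned-Γ m rs)))

Ψ-analysis : ∀ n L → IsLabeledDyck n L → Σ (List ℕ) λ rs →
  IsPerm (2 * n) rs × Up (0 ∷ rs) × build rs ≡ initEntries 1 L × Ψ L ≡ just (unsigned (Γ (2 * n) rs))
Ψ-analysis n L (len , lb)
  with rs , up , evenRs , built ← decompose (initEntries 1 L) (<-wellFounded _) (initEntries-evenState L lb) =
  rs , perm , up , built ,
  trans (cong₂ (λ i es → ψRun i i es []) len (sym built))
        (proj₂ (ψRun-build (2 * n) rs up (odd?-double n) perm))
  where
  perm : IsPerm (2 * n) rs
  perm = ↭-trans (↭-sym (indices-build rs evenRs))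
           (↭-reflexive (begin
             indices (build rs)          ≡⟨ cong indices built ⟩
             indices (initEntries 1 L)   ≡⟨ indices-initEntries 1 L suc (λ _ → refl) ⟩
             applyUpTo suc (length L)    ≡⟨ cong (applyUpTo suc) len ⟩
             applyUpTo suc (2 * n)       ∎))
    where open ≡-Reasoning

Ψ-synthesis : ∀ n rs → Up (0 ∷ rs) → IsPerm (2 * n) rs →
  Σ LPath λ L → IsLabeledDyck n L × Ψ L ≡ just (unsigned (Γ (2 * n) rs))
Ψ-synthesis n rs up perm =
  let evenState bal asc _ , run = ψRun-build (2 * n) rs up (odd?-double n) perm
      es = build rs
      perm′ : IsPerm (2 * n) (indices es)
      perm′ = ↭-trans (indices-build rs (trans (cong odd? (isPerm-length perm)) (odd?-double n))) perm
      len : length es ≡ 2 * n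
      len = trans (sym (Listₚ.length-map index es)) (isPerm-length perm′)
      bounded = subst (λ t → All (λ e → index e ≤ t) es) (sym len)
                      (Allₚ.map⁻ (All.map proj₂ (isPerm-inRange perm′)))
      lenL = trans (Listₚ.length-map _ es) len
      canonical = initEntries-strip 0 es asc bounded (ballot-natural 0 0 0 es bal)
  in strip es , (lenL , Ballot⇒LB 0 0 es bal) ,
     trans (cong₂ (λ i es → ψRun i i es []) lenL canonical) run

Ψ-dyck-alternating : ∀ n L → IsLabeledDyck n L →
  Σ (List ℕ) λ π → IsAlternatingPerm (2 * n) π × Ψ L ≡ just (unsigned π)
Ψ-dyck-alternating n L dyck with rs , perm , up , _ , ΨL ← Ψ-analysis n L dyck =
  Γ (2 * n) rs , (Γ-isPerm perm , Γ-Down perm (odd?-double n) (Up⇒Down-tail 0 rs up)) , ΨL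

Ψ-dyck-injective : ∀ n L L′ → IsLabeledDyck n L → IsLabeledDyck n L′ → Ψ L ≡ Ψ L′ → L ≡ L′
Ψ-dyck-injective n L L′ dyck dyck′ ΨL≡ΨL′
  with rs  , perm  , _ , built  , ΨL  ← Ψ-analysis n L  dyck
     | rs′ , perm′ , _ , built′ , ΨL′ ← Ψ-analysis n L′ dyck′ = begin
  L                        ≡⟨ strip-initEntries 1 L ⟨
  strip (initEntries 1 L)  ≡⟨ cong strip built ⟨
  strip (build rs)         ≡⟨ cong (strip ∘ build) (Γ-injective perm perm′ Γrs≡Γrs′) ⟩
  strip (build rs′)        ≡⟨ cong strip built′ ⟩
  strip (initEntries 1 L′) ≡⟨ strip-initEntries 1 L′ ⟩
  L′                       ∎
  where
  open ≡-Reasoning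
  Γrs≡Γrs′ = unsigned-injective (just-injective (trans (sym ΨL) (trans ΨL≡ΨL′ ΨL′)))

Ψ-dyck-surjective : ∀ n π → IsAlternatingPerm (2 * n) π →
  Σ LPath λ L → IsLabeledDyck n L × Ψ L ≡ just (unsigned π)
Ψ-dyck-surjective n π (perm , down) =
  let permΓ = Γ-isPerm perm
      up = Up-fromZero (Γ (2 * n) π) (All.map proj₁ (isPerm-inRange permΓ))
                       (Γ-Down perm (odd?-double n) down)
      L , dyck , ΨL = Ψ-synthesis n (Γ (2 * n) π) up permΓ
  in L , dyck , trans ΨL (cong (just ∘ unsigned) (Γ-involutive perm))

mainTheorem6 : (n : ℕ) → n ≥ 1 →
    ((L : LPath) → IsLabeledDyck n L →
       Σ (List ℕ) (λ π → IsAlternatingPerm (2 * n) π × Ψ L ≡ just (unsigned π)))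
    × ((L L′ : LPath) → IsLabeledDyck n L → IsLabeledDyck n L′ → Ψ L ≡ Ψ L′ → L ≡ L′)
    × ((π : List ℕ) → IsAlternatingPerm (2 * n) π →
       Σ LPath (λ L → IsLabeledDyck n L × Ψ L ≡ just (unsigned π)))
mainTheorem6 n _ = Ψ-dyck-alternating n , Ψ-dyck-injective n , Ψ-dyck-surjective n
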